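{- Let $N$ be a positive integer with $\sigma^{**}(N)=3N$ and $3^3\mid N$. Then $2^5\,\|\,N$ does not hold (i.e. it is not the case that $2^5\mid N$ and $2^6\nmid N$).
   Context: $\sigma^{**}(N)$ is the sum of the biunitary divisors of $N$, where a divisor $d$ of $N$ is biunitary if the greatest common unitary divisor of $d$ and $N/d$ is $1$ (a divisor $d$ of $m$ being unitary if $\gcd(d,m/d)=1$). -}

module Defs where

open import Data.Nat using (ℕ; zero; suc; _+_; _*_; _^_; _≡ᵇ_)
open import Data.Nat.Divisibility using (_∣_; _∣?_)
open import Data.Nat.DivMod using (_/_)
open import Data.Nat.GCD using (gcd)
open import Data.Bool using (Bool; true; false; _∧_; not)
open import Data.List using (List; []; _∷_; filter)
open import Data.Bool.ListAction using (any)
open import Data.Nat.ListAction using (sum)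
open import Data.Bool using (T?)
open import Data.List.Base using (applyUpTo)
open import Relation.Nullary.Decidable using (⌊_⌋)

range1 : ℕ → List ℕ
range1 n = applyUpTo suc n

isUnitaryDivisor : ℕ → ℕ → Bool
isUnitaryDivisor zero m = false
isUnitaryDivisor d@(suc _) m = ⌊ d ∣? m ⌋ ∧ (gcd d (m / d) ≡ᵇ 1)

-- the greatest common unitary divisor of a and b (a, b ≥ 1) is 1,
-- i.e. no common unitary divisor e > 1 (every such e is ≤ a)
gcudIsOne : ℕ → ℕ → Bool
gcudIsOne a b =
  not (any (λ e → not (e ≡ᵇ 1) ∧ isUnitaryDivisor e a ∧ isUnitaryDivisor e b) (range1 a))

isBiunitaryDivisor : ℕ → ℕ → Bool
isBiunitaryDivisor zero N = false
isBiunitaryDivisor d@(suc _) N = ⌊ d ∣? N ⌋ ∧ gcudIsOne d (N / d)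

σ** : ℕ → ℕ
σ** N = sum (filter (λ d → T? (isBiunitaryDivisor d N)) (range1 N))

-- Write N = 2⁵ m with m odd.  As 2⁵ is a unitary divisor of N and σ** is multiplicative,
-- σ**(N) = σ**(2⁵) σ**(m) = 63 σ**(m), so σ**(N) = 3N becomes 21 σ**(m) = 32 m; in particular 7 ∣ m.
-- The abundancy σ**(n)/n is multiplicative, and on a prime power pᵏ it is bounded below through
-- the biunitary divisors pᵏ, pᵏ⁻¹ (present unless k = 2) and pᵏ⁻² (present unless k = 4).
-- Write m = 3ᵃ 7ᵇ m′ with a ≥ 3 and b ≥ 1, so that σ**(3ᵃ)/3ᵃ ≥ 112/81.  If b ≠ 2 then
-- σ**(m)/m ≥ 112/81 · 8/7 > 32/21.  So b = 2, and σ**(7²) = 50 gives 5 ∣ m′ = 5ᶜ r; c ≠ 2 is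
-- excluded by 112/81 · 50/49 · 6/5 > 32/21.  For c = 2 the bound 13/9 · 50/49 · 26/25 > 32/21
-- forces a = 4, and then 2⁶ ∣ σ**(3⁴) σ**(7²) σ**(5²) ∣ σ**(m), so 2⁶ ∣ 32 m and m is even.

module Submission where

open import Defs
open import Data.Nat using (ℕ; _*_; _^_; _<_)
open import Data.Nat.Divisibility using (_∣_)
open import Data.Product using (_×_)
open import Relation.Nullary using (¬_)
open import Relation.Binary.PropositionalEquality using (_≡_)

open import Data.Nat.Base
  using ( zero; suc; _+_; _≤_; _≡ᵇ_; _≤ᵇ_; z≤n; s≤s
        ; NonZero; NonTrivial; ≢-nonZero⁻¹; nonTrivial⇒n>1; nonTrivial⇒≢1)
open import Data.Nat.Properties
open import Data.Nat.Divisibility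
  using ( divides; _∣?_; 1∣_; ∣-trans; ∣-refl; ∣1⇒≡1; ∣⇒≤
        ; *-cancelˡ-∣; *-monoˡ-∣; *-pres-∣; ∣m⇒∣m*n; ∣n⇒∣m*n; m∣m*n; n∣m*n)
open import Data.Nat.DivMod using (_/_; m*n/n≡m; m*[n/m]≡n)
open import Data.Nat.GCD using (gcd; GCD; gcd-GCD; gcd[m,n]∣m; gcd[m,n]∣n; gcd-greatest)
open import Data.Nat.Coprimality as Coprime
  using (Coprime; coprime-divisor; coprime-/gcd; gcd≡1⇒coprime; coprime⇒gcd≡1)
open import Data.Nat.Primality using (Prime; prime?; prime[2]; prime⇒irreducible; prime⇒nonTrivial; prime⇒nonZero)
open import Data.Nat.Induction using (<-wellFounded)
open import Induction.WellFounded using (Acc; acc)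
open import Data.Product using (∃-syntax; _,_; proj₁; uncurry)
open import Data.Sum using (_⊎_; inj₁; inj₂)
open import Relation.Binary.Definitions using (tri<; tri≈; tri>)
open import Data.Empty using (⊥)
open import Relation.Nullary using (yes; no; contradiction)
open import Data.Unit using (tt)
open import Relation.Binary.PropositionalEquality
  using (refl; sym; trans; cong; cong₂; subst; subst₂; _≢_; module ≡-Reasoning)
open import Data.Nat.Tactic.RingSolver using (solve-∀)
open import Algebra.Properties.CommutativeSemigroup *-commutativeSemigroup
  using (x∙yz≈yx∙z; xy∙z≈y∙xz; x∙yz≈y∙xz) renaming (interchange to *-interchange)
open import Data.Bool.Base using (Bool; true; false; T; not; _∧_)
open import Data.Bool.Properties using (T-∧; T-not-≡)
open import Data.Bool.ListAction using (any)
open import Data.List.Base using (List; []; _∷_; _++_; map; filter; cartesianProduct)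
open import Data.List.Properties using (map-++)
open import Data.List.Relation.Unary.Any using (here; there)
open import Data.List.Relation.Unary.All as All using ()
import Data.List.Relation.Unary.All.Properties as All
open import Data.List.Relation.Binary.Subset.Propositional using (_⊆_)
open import Data.List.Relation.Binary.Permutation.Propositional.Properties using (shift; ∈-resp-↭)
open import Data.Nat.ListAction using (sum)
open import Data.Nat.ListAction.Properties using (sum-++; sum-↭)
open import Data.List.Membership.Propositional using (_∈_; lose; find)
open import Data.List.Membership.Propositional.Properties
  using ( ∈-∃++; ∈-map⁺; ∈-map⁻; ∈-cartesianProduct⁺; ∈-cartesianProduct⁻
        ; ∈-applyUpTo⁺; ∈-applyUpTo⁻; ∈-filter⁺; ∈-filter⁻)
open import Data.List.Relation.Unary.Any.Properties using (any⁺; any⁻)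
open import Data.List.Relation.Unary.Unique.Propositional using (Unique; []; _∷_)
import Data.List.Relation.Unary.Unique.Propositional.Properties as Unique
open import Function.Base using (_∘_)
open import Function.Bundles using (Equivalence; _⇔_; mk⇔)
open import Relation.Nullary.Decidable using (T?; ⌊_⌋; from-yes; toWitness; fromWitness; decidable-stable)
open Equivalence using (to; from)

private variable a b c d e k m n p r x y : ℕ

-- Coprimality and prime powers

coprime-∣ˡ : Coprime a b → c ∣ a → Coprime c b
coprime-∣ˡ a⊥b c∣a (d∣c , d∣b) = a⊥b (∣-trans d∣c c∣a , d∣b)

coprime-∣ʳ : Coprime a b → c ∣ b → Coprime a c
coprime-∣ʳ a⊥b c∣b = Coprime.sym (coprime-∣ˡ (Coprime.sym a⊥b) c∣b)

coprime-*ʳ : Coprime a b → Coprime a c → Coprime a (b * c)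
coprime-*ʳ a⊥b a⊥c (d∣a , d∣bc) = a⊥c (d∣a , coprime-divisor (coprime-∣ˡ a⊥b d∣a) d∣bc)

coprime-^ʳ : Coprime a b → ∀ k → Coprime a (b ^ k)
coprime-^ʳ a⊥b zero    (_ , d∣1) = ∣1⇒≡1 d∣1
coprime-^ʳ a⊥b (suc k) = coprime-*ʳ a⊥b (coprime-^ʳ a⊥b k)

prime∤⇒coprime : Prime p → ¬ p ∣ n → Coprime p n
prime∤⇒coprime pp p∤n (d∣p , d∣n) with prime⇒irreducible pp d∣p
... | inj₁ d≡1 = d≡1
... | inj₂ refl = contradiction d∣n p∤n

prime∤⇒coprime-^ : Prime p → ¬ p ∣ n → ∀ k → Coprime (p ^ k) n
prime∤⇒coprime-^ pp p∤n k = Coprime.sym (coprime-^ʳ (Coprime.sym (prime∤⇒coprime pp p∤n)) k)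

∣⇒nonZero : .{{_ : NonZero n}} → d ∣ n → NonZero d
∣⇒nonZero {n} {zero}  (divides q n≡q*0) = contradiction (trans n≡q*0 (*-zeroʳ q)) (≢-nonZero⁻¹ n)
∣⇒nonZero {n} {suc d} _                 = _

∤⇒nonZero : ¬ d ∣ n → NonZero n
∤⇒nonZero {d} {zero}  d∤0 = contradiction (divides 0 refl) d∤0
∤⇒nonZero {d} {suc n} _   = _

*≡⇒∣ : d * e ≡ n → d ∣ n
*≡⇒∣ {d} {e} de≡n = divides e (trans (sym de≡n) (*-comm d e))

∣⇒∃* : d ∣ n → ∃[ e ] d * e ≡ n
∣⇒∃* {d} (divides e refl) = e , *-comm d e

*≡⇒/≡ : .{{_ : NonZero d}} → d * e ≡ n → n / d ≡ e
*≡⇒/≡ {d} {e} refl = trans (cong (_/ d) (*-comm d e)) (m*n/n≡m e d)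

^-≢ : 1 < p → x ≢ y → p ^ x ≢ p ^ y
^-≢ {p} {x} {y} 1<p x≢y with <-cmp x y
... | tri< x<y _ _ = <⇒≢ (^-monoʳ-< p 1<p x<y)
... | tri≈ _ x≡y _ = contradiction x≡y x≢y
... | tri> _ _ x>y = >⇒≢ (^-monoʳ-< p 1<p x>y)

∣prime-^∧∤⇒≡1 : Prime p → ∀ i → d ∣ p ^ i → ¬ p ∣ d → d ≡ 1
∣prime-^∧∤⇒≡1 pp i d∣pⁱ p∤d = coprime-^ʳ (Coprime.sym (prime∤⇒coprime pp p∤d)) i (∣-refl , d∣pⁱ)

maximal-power-split : ∀ p .{{_ : NonTrivial p}} n .{{_ : NonZero n}} →
                      ∃[ k ] ∃[ r ] n ≡ p ^ k * r × ¬ p ∣ r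
maximal-power-split p n = go n (<-wellFounded n)
  where
  go : ∀ n → Acc _<_ n → .{{NonZero n}} → ∃[ k ] ∃[ r ] n ≡ p ^ k * r × ¬ p ∣ r
  go n (acc rec) with p ∣? n
  ... | no p∤n = 0 , n , sym (*-identityˡ n) , p∤n
  ... | yes (divides q refl) =
    let instance _ = m*n≢0⇒m≢0 q
        k , r , q≡pᵏr , p∤r = go q (rec (m<m*n q p (nonTrivial⇒n>1 p)))
    in suc k , r , trans (cong (_* p) q≡pᵏr) (trans (*-comm _ p) (sym (*-assoc p _ r))) , p∤r

maximal-power-split⁺ : ∀ p .{{_ : NonTrivial p}} n .{{_ : NonZero n}} → p ∣ n →
                       ∃[ k ] ∃[ r ] n ≡ p ^ suc k * r × ¬ p ∣ r
maximal-power-split⁺ p n p∣n with maximal-power-split p n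
... | zero  , r , refl , p∤r = contradiction (subst (p ∣_) (*-identityˡ r) p∣n) p∤r
... | suc k , r , n≡   , p∤r = k , r , n≡ , p∤r

^∣^*⇒≤ : .{{_ : NonZero p}} → ∀ j k → ¬ p ∣ r → p ^ j ∣ p ^ k * r → j ≤ k
^∣^*⇒≤ zero    k       _   _ = z≤n
^∣^*⇒≤ {p} {r} (suc j) zero    p∤r pʲ⁺¹∣r =
  contradiction (∣-trans (m∣m*n (p ^ j)) (subst (p ^ suc j ∣_) (*-identityˡ r) pʲ⁺¹∣r)) p∤r
^∣^*⇒≤ {p} {r} (suc j) (suc k) p∤r pʲ⁺¹∣pᵏ⁺¹r =
  s≤s (^∣^*⇒≤ j k p∤r (*-cancelˡ-∣ p (subst (p ^ suc j ∣_) (*-assoc p (p ^ k) r) pʲ⁺¹∣pᵏ⁺¹r)))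

-- Unitary and biunitary divisors

infix 4 _∥_

-- Unitary divisor: for a prime power this is the exact division 2⁵ ∥ N of the statement.
_∥_ : ℕ → ℕ → Set
e ∥ n = ∃[ f ] e * f ≡ n × Coprime e f

UnitarilyCoprime : ℕ → ℕ → Set
UnitarilyCoprime a b = ∀ e → e ∥ a → e ∥ b → e ≡ 1

BiunitaryDivisor : ℕ → ℕ → Set
BiunitaryDivisor d n = ∃[ q ] d * q ≡ n × UnitarilyCoprime d q

∥⇒∣ : e ∥ n → e ∣ n
∥⇒∣ (_ , ef≡n , _) = *≡⇒∣ ef≡n

BiunitaryDivisor⇒∣ : BiunitaryDivisor d n → d ∣ n
BiunitaryDivisor⇒∣ (_ , dq≡n , _) = *≡⇒∣ dq≡n

BiunitaryDivisor-refl : ∀ n → BiunitaryDivisor n n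
BiunitaryDivisor-refl n = 1 , *-identityʳ n , λ e _ (f , ef≡1 , _) → m*n≡1⇒m≡1 e f ef≡1

∥-prime-^ : Prime p → ∀ i → e ∥ p ^ i → e ≡ 1 ⊎ e ≡ p ^ i
∥-prime-^ {p} {e} pp i (f , ef≡pⁱ , e⊥f) with p ∣? e
... | no p∤e = inj₁ (∣prime-^∧∤⇒≡1 pp i (*≡⇒∣ ef≡pⁱ) p∤e)
... | yes p∣e = inj₂ (trans (sym (*-identityʳ e)) (trans (cong (e *_) (sym f≡1)) ef≡pⁱ))
  where
  f≡1 : f ≡ 1
  f≡1 = ∣prime-^∧∤⇒≡1 pp i (*≡⇒∣ (trans (*-comm f e) ef≡pⁱ))
          λ p∣f → nonTrivial⇒≢1 {{prime⇒nonTrivial pp}} (e⊥f (p∣e , p∣f))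

BiunitaryDivisor-prime-^ : Prime p → ∀ i j → i ≢ j → BiunitaryDivisor (p ^ i) (p ^ (j + i))
BiunitaryDivisor-prime-^ {p} pp i j i≢j =
  p ^ j , trans (sym (^-distribˡ-+-* p i j)) (cong (p ^_) (+-comm i j)) , pⁱ⊥ᵤpʲ
  where
  pⁱ⊥ᵤpʲ : UnitarilyCoprime (p ^ i) (p ^ j)
  pⁱ⊥ᵤpʲ e e∥pⁱ e∥pʲ with ∥-prime-^ pp i e∥pⁱ | ∥-prime-^ pp j e∥pʲ
  ... | inj₁ e≡1    | _            = e≡1
  ... | inj₂ _      | inj₁ e≡1     = e≡1
  ... | inj₂ e≡pⁱ   | inj₂ e≡pʲ    =
    contradiction (trans (sym e≡pⁱ) e≡pʲ) (^-≢ (nonTrivial⇒n>1 p {{prime⇒nonTrivial pp}}) i≢j)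

T-not⇒¬T : ∀ {b} → T (not b) → ¬ T b
T-not⇒¬T t tb = subst T (to T-not-≡ t) tb

¬T⇒T-not : ∀ b → ¬ T b → T (not b)
¬T⇒T-not false _  = _
¬T⇒T-not true  ¬t = ¬t _

∈-range1⁺ : .{{_ : NonZero d}} → d ≤ n → d ∈ range1 n
∈-range1⁺ {suc d} d<n = ∈-applyUpTo⁺ suc d<n

∈-range1⁻ : d ∈ range1 n → NonZero d × d ≤ n
∈-range1⁻ d∈ with _ , i<n , refl ← ∈-applyUpTo⁻ suc d∈ = _ , i<n

isUnitaryDivisor⇔∥ : ∀ e n .{{_ : NonZero e}} → T (isUnitaryDivisor e n) ⇔ e ∥ n
isUnitaryDivisor⇔∥ e@(suc _) n = mk⇔ sound complete
  where
  sound : T (isUnitaryDivisor e n) → e ∥ n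
  sound t = let e∣n , gcd≡1 = to (T-∧ {⌊ e ∣? n ⌋}) t in
    n / e , m*[n/m]≡n (toWitness e∣n) , gcd≡1⇒coprime (≡ᵇ⇒≡ _ 1 gcd≡1)
  complete : e ∥ n → T (isUnitaryDivisor e n)
  complete (f , ef≡n , e⊥f) = from (T-∧ {⌊ e ∣? n ⌋})
    (fromWitness (*≡⇒∣ ef≡n) , ≡⇒≡ᵇ _ 1 (trans (cong (gcd e) (*≡⇒/≡ ef≡n)) (coprime⇒gcd≡1 e⊥f)))

gcudIsOne⇔UnitarilyCoprime : ∀ a b .{{_ : NonZero a}} → T (gcudIsOne a b) ⇔ UnitarilyCoprime a b
gcudIsOne⇔UnitarilyCoprime a b = mk⇔ sound complete
  where
  P : ℕ → Bool
  P e = not (e ≡ᵇ 1) ∧ (isUnitaryDivisor e a ∧ isUnitaryDivisor e b)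
  sound : T (gcudIsOne a b) → UnitarilyCoprime a b
  sound t e e∥a@(f , ef≡a , _) e∥b = decidable-stable (e ≟ 1) λ e≢1 →
    T-not⇒¬T {any P (range1 a)} t (any⁺ P (lose {x = e} (∈-range1⁺ (∣⇒≤ (*≡⇒∣ ef≡a)))
      (from (T-∧ {not (e ≡ᵇ 1)}) (¬T⇒T-not _ (e≢1 ∘ ≡ᵇ⇒≡ e 1) ,
        from (T-∧ {isUnitaryDivisor e a})
          (from (isUnitaryDivisor⇔∥ e a) e∥a , from (isUnitaryDivisor⇔∥ e b) e∥b)))))
    where instance _ = ∣⇒nonZero (*≡⇒∣ ef≡a)
  complete : UnitarilyCoprime a b → T (gcudIsOne a b)
  complete a⊥ᵤb = ¬T⇒T-not (any P (range1 a)) λ t →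
    let e , e∈ , Pe = find (any⁻ P (range1 a) t)
        instance _ = proj₁ (∈-range1⁻ e∈)
        e≢1 , ud = to (T-∧ {not (e ≡ᵇ 1)}) Pe
        e∥a , e∥b = to (T-∧ {isUnitaryDivisor e a}) ud
    in T-not⇒¬T e≢1 (≡⇒≡ᵇ e 1
         (a⊥ᵤb e (to (isUnitaryDivisor⇔∥ e a) e∥a) (to (isUnitaryDivisor⇔∥ e b) e∥b)))

isBiunitaryDivisor⇔ : ∀ d n .{{_ : NonZero d}} → T (isBiunitaryDivisor d n) ⇔ BiunitaryDivisor d n
isBiunitaryDivisor⇔ d@(suc _) n = mk⇔ sound complete
  where
  sound : T (isBiunitaryDivisor d n) → BiunitaryDivisor d n
  sound t = let d∣n , gcud = to (T-∧ {⌊ d ∣? n ⌋}) t in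
    n / d , m*[n/m]≡n (toWitness d∣n) , to (gcudIsOne⇔UnitarilyCoprime d (n / d)) gcud
  complete : BiunitaryDivisor d n → T (isBiunitaryDivisor d n)
  complete (q , dq≡n , d⊥ᵤq) = from (T-∧ {⌊ d ∣? n ⌋}) (fromWitness (*≡⇒∣ dq≡n) ,
    from (gcudIsOne⇔UnitarilyCoprime d (n / d)) (subst (UnitarilyCoprime d) (sym (*≡⇒/≡ dq≡n)) d⊥ᵤq))

-- σ** n is definitionally sum (biunitaryDivisors n).
biunitaryDivisors : ℕ → List ℕ
biunitaryDivisors n = filter (λ d → T? (isBiunitaryDivisor d n)) (range1 n)

∈-biunitaryDivisors⁺ : .{{_ : NonZero n}} → BiunitaryDivisor d n → d ∈ biunitaryDivisors n
∈-biunitaryDivisors⁺ {n} {d} bd@(q , dq≡n , _) =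
  ∈-filter⁺ (λ d → T? (isBiunitaryDivisor d n)) (∈-range1⁺ d≤n) (from (isBiunitaryDivisor⇔ d n) bd)
  where
  instance _ = ∣⇒nonZero (*≡⇒∣ dq≡n)
  d≤n = ∣⇒≤ (*≡⇒∣ dq≡n)

∈-biunitaryDivisors⁻ : d ∈ biunitaryDivisors n → BiunitaryDivisor d n
∈-biunitaryDivisors⁻ {d} {n} d∈ =
  let d∈range , t = ∈-filter⁻ (λ d → T? (isBiunitaryDivisor d n)) {xs = range1 n} d∈
      instance _ = proj₁ (∈-range1⁻ d∈range)
  in to (isBiunitaryDivisor⇔ d n) t

biunitaryDivisors-unique : ∀ n → Unique (biunitaryDivisors n)
biunitaryDivisors-unique n = Unique.filter⁺ (λ d → T? (isBiunitaryDivisor d n))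
  (Unique.applyUpTo⁺₁ suc n (λ i<j _ → <⇒≢ i<j ∘ suc-injective))

-- Multiplicativity of σ**

∥-*ʳ : e ∥ a → Coprime e b → e ∥ a * b
∥-*ʳ {e} {a} {b} (f , ef≡a , e⊥f) e⊥b =
  f * b , trans (sym (*-assoc e f b)) (cong (_* b) ef≡a) , coprime-*ʳ e⊥f e⊥b

gcd-∥ : .{{_ : NonZero a}} → e ∥ n → a ∣ n → gcd e a ∥ a
gcd-∥ {a} {e} {n} (f , ef≡n , e⊥f) a∣n = a / g , g*[a/g]≡a , g⊥a/g
  where
  g = gcd e a
  instance _ = ∣⇒nonZero (gcd[m,n]∣n e a)
  g*[a/g]≡a : g * (a / g) ≡ a
  g*[a/g]≡a = m*[n/m]≡n (gcd[m,n]∣n e a)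
  g*[[e/g]*f]≡n : g * (e / g * f) ≡ n
  g*[[e/g]*f]≡n = trans (sym (*-assoc g _ f)) (trans (cong (_* f) (m*[n/m]≡n (gcd[m,n]∣m e a))) ef≡n)
  a/g∣f : a / g ∣ f
  a/g∣f = coprime-divisor (Coprime.sym (coprime-/gcd e a))
            (*-cancelˡ-∣ g (subst₂ _∣_ (sym g*[a/g]≡a) (sym g*[[e/g]*f]≡n) a∣n))
  g⊥a/g : Coprime g (a / g)
  g⊥a/g (c∣g , c∣a/g) = e⊥f (∣-trans c∣g (gcd[m,n]∣m e a) , ∣-trans c∣a/g a/g∣f)

gcd-∣-coprime-factor : e ∣ a * b → a ∣ x → Coprime b x → gcd e x ≡ gcd e a
gcd-∣-coprime-factor {e} {a} {b} {x} e∣ab a∣x b⊥x = GCD.unique (gcd-GCD e x) (GCD.is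
  (gcd[m,n]∣m e a , ∣-trans (gcd[m,n]∣n e a) a∣x)
  λ {c} (c∣e , c∣x) → gcd-greatest c∣e
    (coprime-divisor (coprime-∣ˡ (Coprime.sym b⊥x) c∣x) (subst (c ∣_) (*-comm a b) (∣-trans c∣e e∣ab))))

-- gcd e (d₁ q₁) is a unitary divisor of both d₁ and q₁, hence 1.
common-∥-coprime : ∀ {d₁ q₁ d₂ q₂} .{{_ : NonZero (d₁ * q₁)}} → Coprime (d₁ * q₁) (d₂ * q₂) →
                   UnitarilyCoprime d₁ q₁ → e ∥ d₁ * d₂ → e ∥ q₁ * q₂ → Coprime e (d₁ * q₁)
common-∥-coprime {e} {d₁} {q₁} {d₂} {q₂} x⊥y d₁⊥ᵤq₁ e∥d e∥q =
  gcd≡1⇒coprime (d₁⊥ᵤq₁ (gcd e (d₁ * q₁))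
    (subst (_∥ d₁) (sym (gcd-∣-coprime-factor (∥⇒∣ e∥d) (m∣m*n q₁) d₂⊥x)) (gcd-∥ e∥d (m∣m*n d₂)))
    (subst (_∥ q₁) (sym (gcd-∣-coprime-factor (∥⇒∣ e∥q) (n∣m*n d₁) q₂⊥x)) (gcd-∥ e∥q (m∣m*n q₂))))
  where
  instance _ = m*n≢0⇒m≢0 d₁ ; _ = m*n≢0⇒n≢0 d₁
  d₂⊥x = coprime-∣ˡ (Coprime.sym x⊥y) (m∣m*n q₂)
  q₂⊥x = coprime-∣ˡ (Coprime.sym x⊥y) (n∣m*n d₂)

UnitarilyCoprime-* : ∀ {d₁ q₁ d₂ q₂} .{{_ : NonZero (d₁ * q₁)}} .{{_ : NonZero (d₂ * q₂)}} →
                     Coprime (d₁ * q₁) (d₂ * q₂) → UnitarilyCoprime d₁ q₁ → UnitarilyCoprime d₂ q₂ →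
                     UnitarilyCoprime (d₁ * d₂) (q₁ * q₂)
UnitarilyCoprime-* {d₁} {q₁} {d₂} {q₂} x⊥y d₁⊥ᵤq₁ d₂⊥ᵤq₂ e e∥d e∥q =
  e⊥y (∣-refl , coprime-divisor e⊥x (∣-trans (∥⇒∣ e∥d) (*-pres-∣ (m∣m*n {d₁} q₁) (m∣m*n {d₂} q₂))))
  where
  e⊥x = common-∥-coprime x⊥y d₁⊥ᵤq₁ e∥d e∥q
  e⊥y = common-∥-coprime (Coprime.sym x⊥y) d₂⊥ᵤq₂
          (subst (e ∥_) (*-comm d₁ d₂) e∥d) (subst (e ∥_) (*-comm q₁ q₂) e∥q)

UnitarilyCoprime-*⁻ : ∀ {d₁ q₁ d₂ q₂} → Coprime (d₁ * q₁) (d₂ * q₂) →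
                      UnitarilyCoprime (d₁ * d₂) (q₁ * q₂) → UnitarilyCoprime d₁ q₁
UnitarilyCoprime-*⁻ {d₁} {q₁} {d₂} {q₂} x⊥y d⊥ᵤq e e∥d₁ e∥q₁ =
  d⊥ᵤq e (∥-*ʳ e∥d₁ (coprime-∣ʳ (coprime-∣ˡ x⊥y (∣-trans (∥⇒∣ e∥d₁) (m∣m*n q₁))) (m∣m*n q₂)))
         (∥-*ʳ e∥q₁ (coprime-∣ʳ (coprime-∣ˡ x⊥y (∣-trans (∥⇒∣ e∥q₁) (n∣m*n d₁))) (n∣m*n d₂)))

BiunitaryDivisor-* : ∀ {d₁ d₂} .{{_ : NonZero x}} .{{_ : NonZero y}} → Coprime x y →
                     BiunitaryDivisor d₁ x → BiunitaryDivisor d₂ y → BiunitaryDivisor (d₁ * d₂) (x * y)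
BiunitaryDivisor-* {d₁ = d₁} {d₂} x⊥y (q₁ , refl , d₁⊥ᵤq₁) (q₂ , refl , d₂⊥ᵤq₂) =
  q₁ * q₂ , *-interchange d₁ d₂ q₁ q₂ , UnitarilyCoprime-* x⊥y d₁⊥ᵤq₁ d₂⊥ᵤq₂

BiunitaryDivisor-*⁻ : ∀ {d₁ d₂} .{{_ : NonZero x}} .{{_ : NonZero y}} → Coprime x y → d₁ ∣ x → d₂ ∣ y →
                      BiunitaryDivisor (d₁ * d₂) (x * y) → BiunitaryDivisor d₁ x × BiunitaryDivisor d₂ y
BiunitaryDivisor-*⁻ {x} {y} {d₁} {d₂} x⊥y d₁∣x d₂∣y (q , dq≡xy , d⊥ᵤq)
  with q₁ , refl ← ∣⇒∃* d₁∣x | q₂ , refl ← ∣⇒∃* d₂∣y =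
  (q₁ , refl , UnitarilyCoprime-*⁻ x⊥y d⊥ᵤq₁q₂) ,
  (q₂ , refl , UnitarilyCoprime-*⁻ (Coprime.sym x⊥y)
                 (subst₂ UnitarilyCoprime (*-comm d₁ d₂) (*-comm q₁ q₂) d⊥ᵤq₁q₂))
  where
  instance _ = m*n≢0 d₁ d₂ {{m*n≢0⇒m≢0 d₁}} {{m*n≢0⇒m≢0 d₂}}
  d⊥ᵤq₁q₂ : UnitarilyCoprime (d₁ * d₂) (q₁ * q₂)
  d⊥ᵤq₁q₂ = subst (UnitarilyCoprime (d₁ * d₂))
    (*-cancelˡ-≡ q (q₁ * q₂) (d₁ * d₂) (trans dq≡xy (sym (*-interchange d₁ d₂ q₁ q₂)))) d⊥ᵤq

∣-*-split : .{{_ : NonZero x}} → d ∣ x * y → ∃[ d₁ ] ∃[ d₂ ] d₁ ∣ x × d₂ ∣ y × d₁ * d₂ ≡ d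
∣-*-split {x} {d} {y} d∣xy = g , d / g , gcd[m,n]∣n d x , d/g∣y , m*[n/m]≡n (gcd[m,n]∣m d x)
  where
  g = gcd d x
  instance _ = ∣⇒nonZero (gcd[m,n]∣n d x)
  g*[[x/g]*y]≡xy : g * (x / g * y) ≡ x * y
  g*[[x/g]*y]≡xy = trans (sym (*-assoc g _ y)) (cong (_* y) (m*[n/m]≡n (gcd[m,n]∣n d x)))
  d/g∣y : d / g ∣ y
  d/g∣y = coprime-divisor (coprime-/gcd d x)
    (*-cancelˡ-∣ g (subst₂ _∣_ (sym (m*[n/m]≡n (gcd[m,n]∣m d x))) (sym g*[[x/g]*y]≡xy) d∣xy))

GCD-*-coprime : a ∣ x → Coprime b x → GCD (a * b) x a
GCD-*-coprime {a} {x} {b} a∣x b⊥x = GCD.is (m∣m*n b , a∣x) λ {c} (c∣ab , c∣x) →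
  coprime-divisor (coprime-∣ˡ (Coprime.sym b⊥x) c∣x) (subst (c ∣_) (*-comm a b) c∣ab)

*-injective-on-coprime-divisors : ∀ {a′ b′} .{{_ : NonZero x}} → Coprime x y →
  a ∣ x → b ∣ y → a′ ∣ x → b′ ∣ y → a * b ≡ a′ * b′ → a ≡ a′ × b ≡ b′
*-injective-on-coprime-divisors {x} {y} {a} {b} {a′} {b′} x⊥y a∣x b∣y a′∣x b′∣y ab≡a′b′ =
  a≡a′ , *-cancelˡ-≡ b b′ a (trans ab≡a′b′ (cong (_* b′) (sym a≡a′)))
  where
  instance _ = ∣⇒nonZero a∣x
  a≡a′ : a ≡ a′
  a≡a′ = GCD.unique (GCD-*-coprime a∣x (coprime-∣ˡ (Coprime.sym x⊥y) b∣y))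
    (subst (λ n → GCD n x a′) (sym ab≡a′b′) (GCD-*-coprime a′∣x (coprime-∣ˡ (Coprime.sym x⊥y) b′∣y)))

sum-⊆-≤ : ∀ {xs ys} → Unique xs → xs ⊆ ys → sum xs ≤ sum ys
sum-⊆-≤ {[]}     _            _     = z≤n
sum-⊆-≤ {x ∷ xs} (x∉xs ∷ xs!) x∷xs⊆ys with as , bs , refl ← ∈-∃++ (x∷xs⊆ys (here refl)) =
  subst (x + sum xs ≤_) (sym (sum-↭ (shift x as bs)))
    (+-monoʳ-≤ x (sum-⊆-≤ xs! λ z∈xs →
      drop-head (All.lookup x∉xs z∈xs) (∈-resp-↭ (shift x as bs) (x∷xs⊆ys (there z∈xs)))))
  where
  drop-head : ∀ {z zs} → x ≢ z → z ∈ x ∷ zs → z ∈ zs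
  drop-head x≢z (here z≡x) = contradiction (sym z≡x) x≢z
  drop-head x≢z (there z∈zs) = z∈zs

Unique-map⁺-injectiveOn : ∀ {A B : Set} {f : A → B} {zs} → Unique zs →
              (∀ {a b} → a ∈ zs → b ∈ zs → f a ≡ f b → a ≡ b) → Unique (map f zs)
Unique-map⁺-injectiveOn {zs = []}     []           _     = []
Unique-map⁺-injectiveOn {zs = z ∷ zs} (z∉zs ∷ zs!) f-inj =
  All.map⁺ (All.tabulate λ w∈zs fz≡fw → All.lookup z∉zs w∈zs (f-inj (here refl) (there w∈zs) fz≡fw))
  ∷ Unique-map⁺-injectiveOn zs! (λ a∈ b∈ → f-inj (there a∈) (there b∈))

sum-map-*-cartesianProduct : ∀ xs ys → sum (map (uncurry _*_) (cartesianProduct xs ys)) ≡ sum xs * sum ys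
sum-map-*-cartesianProduct []       ys = refl
sum-map-*-cartesianProduct (x ∷ xs) ys = begin
  sum (map (uncurry _*_) (map (x ,_) ys ++ cartesianProduct xs ys))
    ≡⟨ cong sum (map-++ (uncurry _*_) (map (x ,_) ys) _) ⟩
  sum (map (uncurry _*_) (map (x ,_) ys) ++ map (uncurry _*_) (cartesianProduct xs ys))
    ≡⟨ sum-++ (map (uncurry _*_) (map (x ,_) ys)) _ ⟩
  sum (map (uncurry _*_) (map (x ,_) ys)) + sum (map (uncurry _*_) (cartesianProduct xs ys))
    ≡⟨ cong₂ _+_ (sum-map-*ˡ ys) (sum-map-*-cartesianProduct xs ys) ⟩
  x * sum ys + sum xs * sum ys
    ≡⟨ sym (*-distribʳ-+ (sum ys) x (sum xs)) ⟩
  (x + sum xs) * sum ys ∎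
  where
  open ≡-Reasoning
  sum-map-*ˡ : ∀ ys → sum (map (uncurry _*_) (map (x ,_) ys)) ≡ x * sum ys
  sum-map-*ˡ []       = sym (*-zeroʳ x)
  sum-map-*ˡ (y ∷ ys) = trans (cong (x * y +_) (sum-map-*ˡ ys)) (sym (*-distribˡ-+ x y (sum ys)))

σ**-* : Coprime x y → σ** (x * y) ≡ σ** x * σ** y
σ**-* {zero}          _ = refl
σ**-* {x@(suc _)} {zero}  _ = trans (cong σ** (*-zeroʳ x)) (sym (*-zeroʳ (σ** x)))
σ**-* {x@(suc _)} {y@(suc _)} x⊥y = ≤-antisym
  (subst (σ** (x * y) ≤_) sum-products (sum-⊆-≤ (biunitaryDivisors-unique (x * y)) divisors⊆products))
  (subst (_≤ σ** (x * y)) sum-products (sum-⊆-≤ products-unique products⊆divisors))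
  where
  products : List ℕ
  products = map (uncurry _*_) (cartesianProduct (biunitaryDivisors x) (biunitaryDivisors y))
  sum-products : sum products ≡ σ** x * σ** y
  sum-products = sum-map-*-cartesianProduct (biunitaryDivisors x) (biunitaryDivisors y)
  divisors⊆products : biunitaryDivisors (x * y) ⊆ products
  divisors⊆products d∈
    with d₁ , d₂ , d₁∣x , d₂∣y , refl ← ∣-*-split {x} (BiunitaryDivisor⇒∣ (∈-biunitaryDivisors⁻ {n = x * y} d∈)) =
    let bd₁ , bd₂ = BiunitaryDivisor-*⁻ x⊥y d₁∣x d₂∣y (∈-biunitaryDivisors⁻ {n = x * y} d∈)
    in ∈-map⁺ (uncurry _*_) (∈-cartesianProduct⁺ (∈-biunitaryDivisors⁺ bd₁) (∈-biunitaryDivisors⁺ bd₂))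
  products⊆divisors : products ⊆ biunitaryDivisors (x * y)
  products⊆divisors p∈ with _ , d₁d₂∈ , refl ← ∈-map⁻ (uncurry _*_) p∈ =
    let d₁∈ , d₂∈ = ∈-cartesianProduct⁻ (biunitaryDivisors x) (biunitaryDivisors y) d₁d₂∈
    in ∈-biunitaryDivisors⁺ (BiunitaryDivisor-* x⊥y (∈-biunitaryDivisors⁻ d₁∈) (∈-biunitaryDivisors⁻ d₂∈))
  products-unique : Unique products
  products-unique = Unique-map⁺-injectiveOn
    (Unique.cartesianProduct⁺ (biunitaryDivisors-unique x) (biunitaryDivisors-unique y))
    λ p∈ p′∈ d₁d₂≡d₁′d₂′ →
      let d₁∈ , d₂∈ = ∈-cartesianProduct⁻ (biunitaryDivisors x) (biunitaryDivisors y) p∈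
          d₁′∈ , d₂′∈ = ∈-cartesianProduct⁻ (biunitaryDivisors x) (biunitaryDivisors y) p′∈
          d₁≡d₁′ , d₂≡d₂′ = *-injective-on-coprime-divisors x⊥y
            (∈-biunitaryDivisors⇒∣ d₁∈) (∈-biunitaryDivisors⇒∣ d₂∈)
            (∈-biunitaryDivisors⇒∣ d₁′∈) (∈-biunitaryDivisors⇒∣ d₂′∈) d₁d₂≡d₁′d₂′
      in cong₂ _,_ d₁≡d₁′ d₂≡d₂′
    where
    ∈-biunitaryDivisors⇒∣ : ∀ {d n} → d ∈ biunitaryDivisors n → d ∣ n
    ∈-biunitaryDivisors⇒∣ = BiunitaryDivisor⇒∣ ∘ ∈-biunitaryDivisors⁻

σ**-*-* : Coprime x (y * r) → Coprime y r → σ** (x * (y * r)) ≡ σ** x * (σ** y * σ** r)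
σ**-*-* {x} x⊥yr y⊥r = trans (σ**-* x⊥yr) (cong (σ** x *_) (σ**-* y⊥r))

-- Abundancy bounds

sum-≤-σ** : ∀ {ds} .{{_ : NonZero n}} → Unique ds → All.All (λ d → BiunitaryDivisor d n) ds →
            sum ds ≤ σ** n
sum-≤-σ** ds! bds = sum-⊆-≤ ds! (∈-biunitaryDivisors⁺ ∘ All.lookup bds)

record AbundancyAtLeast (u v n : ℕ) : Set where
  constructor abundancyAtLeast
  field u*n≤v*σ**n : u * n ≤ v * σ** n

abundancy-exact : ∀ n → AbundancyAtLeast (σ** n) n n
abundancy-exact n = abundancyAtLeast (≤-reflexive (*-comm (σ** n) n))

abundancy-≥1 : .{{_ : NonZero n}} → AbundancyAtLeast 1 1 n
abundancy-≥1 {n} = abundancyAtLeast (subst₂ _≤_ (sym (*-identityˡ n)) (sym (*-identityˡ (σ** n)))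
  (subst (_≤ σ** n) (+-identityʳ n) (sum-≤-σ** (All.[] ∷ []) (BiunitaryDivisor-refl n All.∷ All.[]))))

abundancy-* : ∀ {u₁ v₁ u₂ v₂} → Coprime x y → AbundancyAtLeast u₁ v₁ x → AbundancyAtLeast u₂ v₂ y →
              AbundancyAtLeast (u₁ * u₂) (v₁ * v₂) (x * y)
abundancy-* {x} {y} {u₁} {v₁} {u₂} {v₂} x⊥y (abundancyAtLeast x-bound) (abundancyAtLeast y-bound) =
  abundancyAtLeast (begin
  (u₁ * u₂) * (x * y)             ≡⟨ *-interchange u₁ u₂ x y ⟩
  (u₁ * x) * (u₂ * y)             ≤⟨ *-mono-≤ x-bound y-bound ⟩
  (v₁ * σ** x) * (v₂ * σ** y)     ≡⟨ *-interchange v₁ (σ** x) v₂ (σ** y) ⟩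
  (v₁ * v₂) * (σ** x * σ** y)     ≡⟨ cong ((v₁ * v₂) *_) (sym (σ**-* x⊥y)) ⟩
  (v₁ * v₂) * σ** (x * y)         ∎)
  where open ≤-Reasoning

abundancy-weaken : ∀ {u v u′ v′} .{{_ : NonZero v}} → u′ * v ≤ u * v′ →
                   AbundancyAtLeast u v n → AbundancyAtLeast u′ v′ n
abundancy-weaken {n} {u} {v} {u′} {v′} u′v≤uv′ (abundancyAtLeast bound) =
  abundancyAtLeast (*-cancelˡ-≤ v (begin
  v * (u′ * n)        ≡⟨ x∙yz≈yx∙z v u′ n ⟩
  (u′ * v) * n        ≤⟨ *-monoˡ-≤ n u′v≤uv′ ⟩
  (u * v′) * n        ≡⟨ xy∙z≈y∙xz u v′ n ⟩
  v′ * (u * n)        ≤⟨ *-monoʳ-≤ v′ bound ⟩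
  v′ * (v * σ** n)    ≡⟨ x∙yz≈y∙xz v′ v (σ** n) ⟩
  v * (v′ * σ** n)    ∎))
  where open ≤-Reasoning

abundancy-≤-ratio : ∀ {u v p q} .{{_ : NonZero n}} → q * σ** n ≡ p * n →
                    AbundancyAtLeast u v n → u * q ≤ v * p
abundancy-≤-ratio {n} {u} {v} {p} {q} qσ≡pn (abundancyAtLeast bound) =
  *-cancelʳ-≤ (u * q) (v * p) n (begin
  (u * q) * n       ≡⟨ xy∙z≈y∙xz u q n ⟩
  q * (u * n)       ≤⟨ *-monoʳ-≤ q bound ⟩
  q * (v * σ** n)   ≡⟨ x∙yz≈y∙xz q v (σ** n) ⟩
  v * (q * σ** n)   ≡⟨ cong (v *_) qσ≡pn ⟩
  v * (p * n)       ≡⟨ *-assoc v p n ⟨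
  (v * p) * n       ∎)
  where open ≤-Reasoning

abundancy-prime-^ : Prime p → ∀ k → k ≢ 1 → AbundancyAtLeast (p + 1) p (p ^ suc k)
abundancy-prime-^ {p} pp k k≢1 = abundancyAtLeast (begin
  (p + 1) * p ^ suc k               ≡⟨ identity p (p ^ k) ⟩
  p * sum (p ^ suc k ∷ p ^ k ∷ [])  ≤⟨ *-monoʳ-≤ p (sum-≤-σ** distinct biunitary) ⟩
  p * σ** (p ^ suc k)               ∎)
  where
  open ≤-Reasoning
  instance _ = prime⇒nonZero pp ; _ = m^n≢0 p (suc k)
  identity : ∀ p w → (p + 1) * (p * w) ≡ p * (p * w + (w + 0))
  identity = solve-∀
  distinct : Unique (p ^ suc k ∷ p ^ k ∷ [])
  distinct = (^-≢ {x = suc k} {y = k} (nonTrivial⇒n>1 p {{prime⇒nonTrivial pp}}) (λ ()) All.∷ All.[])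
           ∷ All.[] ∷ []
  biunitary : All.All (λ d → BiunitaryDivisor d (p ^ suc k)) (p ^ suc k ∷ p ^ k ∷ [])
  biunitary = BiunitaryDivisor-refl _ All.∷ BiunitaryDivisor-prime-^ pp k 1 k≢1 All.∷ All.[]

abundancy-prime-^-2+ : Prime p → ∀ k → k ≢ 0 → k ≢ 2 →
                       AbundancyAtLeast (p * p + p + 1) (p * p) (p ^ (2 + k))
abundancy-prime-^-2+ {p} pp k k≢0 k≢2 = abundancyAtLeast (begin
  (p * p + p + 1) * p ^ (2 + k)                    ≡⟨ identity p (p ^ k) ⟩
  (p * p) * sum (p ^ (2 + k) ∷ p ^ (1 + k) ∷ p ^ k ∷ [])  ≤⟨ *-monoʳ-≤ (p * p) (sum-≤-σ** distinct biunitary) ⟩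
  (p * p) * σ** (p ^ (2 + k))                      ∎)
  where
  open ≤-Reasoning
  instance _ = prime⇒nonZero pp ; _ = m^n≢0 p (2 + k)
  identity : ∀ p w → (p * p + p + 1) * (p * (p * w)) ≡ (p * p) * (p * (p * w) + (p * w + (w + 0)))
  identity = solve-∀
  1<p = nonTrivial⇒n>1 p {{prime⇒nonTrivial pp}}
  distinct : Unique (p ^ (2 + k) ∷ p ^ (1 + k) ∷ p ^ k ∷ [])
  distinct = (^-≢ {x = 2 + k} {y = 1 + k} 1<p (λ ()) All.∷ ^-≢ {x = 2 + k} {y = k} 1<p (λ ()) All.∷ All.[])
           ∷ (^-≢ {x = 1 + k} {y = k} 1<p (λ ()) All.∷ All.[]) ∷ All.[] ∷ []
  biunitary : All.All (λ d → BiunitaryDivisor d (p ^ (2 + k))) (p ^ (2 + k) ∷ p ^ (1 + k) ∷ p ^ k ∷ [])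
  biunitary = BiunitaryDivisor-refl _
    All.∷ BiunitaryDivisor-prime-^ pp (1 + k) 1 (k≢0 ∘ suc-injective)
    All.∷ BiunitaryDivisor-prime-^ pp k 2 k≢2 All.∷ All.[]

-- Numerical facts about 3, 5 and 7

prime3 : Prime 3
prime3 = from-yes (prime? 3)

prime5 : Prime 5
prime5 = from-yes (prime? 5)

prime7 : Prime 7
prime7 = from-yes (prime? 7)

abundancy-3^-≢4 : 3 ≤ a → a ≢ 4 → AbundancyAtLeast 13 9 (3 ^ a)
abundancy-3^-≢4 {suc (suc k)} (s≤s (s≤s 1≤k)) a≢4 =
  abundancy-prime-^-2+ prime3 k (>⇒≢ 1≤k) (a≢4 ∘ cong (2 +_))

abundancy-3^ : 3 ≤ a → AbundancyAtLeast 112 81 (3 ^ a)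
abundancy-3^ {a} 3≤a with a ≟ 4
... | yes refl = abundancy-exact (3 ^ 4)
... | no  a≢4  = abundancy-weaken (≤ᵇ⇒≤ (112 * 9) (13 * 81) tt) (abundancy-3^-≢4 3≤a a≢4)

abundancy-7² : AbundancyAtLeast 50 49 (7 ^ 2)
abundancy-7² = abundancy-exact (7 ^ 2)

abundancy-5² : AbundancyAtLeast 26 25 (5 ^ 2)
abundancy-5² = abundancy-exact (5 ^ 2)

-- σ**(3⁴) σ**(7²) σ**(5²) = 112 · 50 · 26 = 2⁶ · 2275
64∣σ**-3⁴7²5² : Coprime (3 ^ 4) (7 ^ 2 * (5 ^ 2 * r)) → Coprime (7 ^ 2) (5 ^ 2 * r) → Coprime (5 ^ 2) r →
                64 ∣ σ** (3 ^ 4 * (7 ^ 2 * (5 ^ 2 * r)))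
64∣σ**-3⁴7²5² {r} 3⁴⊥ 7²⊥ 5²⊥r =
  subst (64 ∣_) (sym (trans (σ**-*-* 3⁴⊥ 7²⊥) (cong (λ s → σ** (3 ^ 4) * (σ** (7 ^ 2) * s)) (σ**-* 5²⊥r))))
  (*-pres-∣ 16∣σ**3⁴ (*-pres-∣ 2∣σ**7² (*-pres-∣ 2∣σ**5² (1∣ σ** r))))
  where
  16∣σ**3⁴ : 16 ∣ σ** (3 ^ 4)
  16∣σ**3⁴ = divides 7 refl
  2∣σ**7² : 2 ∣ σ** (7 ^ 2)
  2∣σ**7² = divides 25 refl
  2∣σ**5² : 2 ∣ σ** (5 ^ 2)
  2∣σ**5² = divides 13 refl

-- Odd solutions of 21 σ**(n) = 32 n

ratio-32/21-∣ : 21 * σ** n ≡ 32 * n → Coprime d 32 → d ∣ 21 * σ** n → d ∣ n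
ratio-32/21-∣ {n} {d} eq d⊥32 d∣21σ = coprime-divisor d⊥32 (subst (d ∣_) eq d∣21σ)

-- For literal u / v > 32 / 21 the result type computes to ⊥.
ratio-32/21-excludes : ∀ {u v} → ¬ 2 ∣ n → 21 * σ** n ≡ 32 * n → n ≡ x →
                       AbundancyAtLeast u v x → T (u * 21 ≤ᵇ v * 32)
ratio-32/21-excludes 2∤n eq refl bound =
  ≤⇒≤ᵇ (abundancy-≤-ratio {p = 32} {q = 21} {{∤⇒nonZero 2∤n}} eq bound)

ratio-32/21-impossible-7²5ᶜ : ¬ 2 ∣ n → 21 * σ** n ≡ 32 * n → n ≡ 3 ^ a * (7 ^ 2 * m) →
                              m ≡ 5 ^ suc c * r → 3 ≤ a → Coprime (3 ^ a) (7 ^ 2 * m) → Coprime (7 ^ 2) m →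
                              ¬ 5 ∣ r → ⊥
ratio-32/21-impossible-7²5ᶜ {a = a} {c = c} 2∤n eq n≡ refl 3≤a 3ᵃ⊥ 7²⊥ 5∤r with c ≟ 1 | a ≟ 4
... | no c≢1   | _        = ratio-32/21-excludes 2∤n eq n≡
  (abundancy-* 3ᵃ⊥ (abundancy-3^ 3≤a) (abundancy-* 7²⊥ abundancy-7²
    (abundancy-* (prime∤⇒coprime-^ prime5 5∤r (suc c)) (abundancy-prime-^ prime5 c c≢1)
      (abundancy-≥1 {{∤⇒nonZero 5∤r}}))))
... | yes refl | no a≢4   = ratio-32/21-excludes 2∤n eq n≡
  (abundancy-* 3ᵃ⊥ (abundancy-3^-≢4 3≤a a≢4) (abundancy-* 7²⊥ abundancy-7²
    (abundancy-* (prime∤⇒coprime-^ prime5 5∤r 2) abundancy-5² (abundancy-≥1 {{∤⇒nonZero 5∤r}}))))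
... | yes refl | yes refl = 2∤n (*-cancelˡ-∣ 32 (subst (64 ∣_) eq (∣n⇒∣m*n 21
  (subst (λ x → 64 ∣ σ** x) (sym n≡) (64∣σ**-3⁴7²5² 3ᵃ⊥ 7²⊥ (prime∤⇒coprime-^ prime5 5∤r 2))))))

ratio-32/21-impossible-7² : ¬ 2 ∣ n → 21 * σ** n ≡ 32 * n → n ≡ 3 ^ a * (7 ^ 2 * m) →
                            3 ≤ a → Coprime (3 ^ a) (7 ^ 2 * m) → ¬ 7 ∣ m → ⊥
ratio-32/21-impossible-7² {n} {a} {m} 2∤n eq n≡ 3≤a 3ᵃ⊥ 7∤m =
  let c , r , m≡ , 5∤r = maximal-power-split⁺ 5 m {{∤⇒nonZero 7∤m}} 5∣m
  in ratio-32/21-impossible-7²5ᶜ {c = c} 2∤n eq n≡ m≡ 3≤a 3ᵃ⊥ 7²⊥m 5∤r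
  where
  7²⊥m : Coprime (7 ^ 2) m
  7²⊥m = prime∤⇒coprime-^ prime7 7∤m 2
  5∣σ** : 5 ∣ σ** n
  5∣σ** = subst (5 ∣_) (sym (trans (cong σ** n≡) (σ**-*-* 3ᵃ⊥ 7²⊥m)))
            (∣n⇒∣m*n (σ** (3 ^ a)) (∣m⇒∣m*n (σ** m) (divides 10 refl)))
  5∣3ᵃ7²m : 5 ∣ 3 ^ a * (7 ^ 2 * m)
  5∣3ᵃ7²m = subst (5 ∣_) n≡ (ratio-32/21-∣ eq (gcd≡1⇒coprime {5} {32} refl) (∣n⇒∣m*n 21 5∣σ**))
  5∣7²m : 5 ∣ 7 ^ 2 * m
  5∣7²m = coprime-divisor (coprime-^ʳ (gcd≡1⇒coprime {5} {3} refl) a) 5∣3ᵃ7²m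
  5∣m : 5 ∣ m
  5∣m = coprime-divisor (gcd≡1⇒coprime {5} {49} refl) 5∣7²m

ratio-32/21-impossible-7ᵏ : ¬ 2 ∣ n → 21 * σ** n ≡ 32 * n → n ≡ 3 ^ a * m → m ≡ 7 ^ suc k * r →
                            3 ≤ a → Coprime (3 ^ a) m → ¬ 7 ∣ r → ⊥
ratio-32/21-impossible-7ᵏ {k = k} 2∤n eq n≡ refl 3≤a 3ᵃ⊥ 7∤r with k ≟ 1
... | no k≢1   = ratio-32/21-excludes 2∤n eq n≡
  (abundancy-* 3ᵃ⊥ (abundancy-3^ 3≤a)
    (abundancy-* (prime∤⇒coprime-^ prime7 7∤r (suc k)) (abundancy-prime-^ prime7 k k≢1)
      (abundancy-≥1 {{∤⇒nonZero 7∤r}})))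
... | yes refl = ratio-32/21-impossible-7² 2∤n eq n≡ 3≤a 3ᵃ⊥ 7∤r

ratio-32/21-impossible-3ᵃ : ¬ 2 ∣ n → 21 * σ** n ≡ 32 * n → n ≡ 3 ^ a * m → 3 ≤ a → ¬ 3 ∣ m → ⊥
ratio-32/21-impossible-3ᵃ {n} {a} {m} 2∤n eq n≡ 3≤a 3∤m =
  let k , r , m≡ , 7∤r = maximal-power-split⁺ 7 m {{∤⇒nonZero 3∤m}} 7∣m
  in ratio-32/21-impossible-7ᵏ {k = k} 2∤n eq n≡ m≡ 3≤a (prime∤⇒coprime-^ prime3 3∤m a) 7∤r
  where
  7∣3ᵃm : 7 ∣ 3 ^ a * m
  7∣3ᵃm = subst (7 ∣_) n≡
    (ratio-32/21-∣ eq (gcd≡1⇒coprime {7} {32} refl) (∣m⇒∣m*n (σ** n) (divides 3 refl)))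
  7∣m : 7 ∣ m
  7∣m = coprime-divisor (coprime-^ʳ (gcd≡1⇒coprime {7} {3} refl) a) 7∣3ᵃm

ratio-32/21-impossible : ¬ 2 ∣ n → 3 ^ 3 ∣ n → 21 * σ** n ≢ 32 * n
ratio-32/21-impossible {n} 2∤n 27∣n eq =
  let a , m , n≡ , 3∤m = maximal-power-split 3 n {{∤⇒nonZero 2∤n}}
  in ratio-32/21-impossible-3ᵃ 2∤n eq n≡ (^∣^*⇒≤ 3 a 3∤m (subst (3 ^ 3 ∣_) n≡ 27∣n)) 3∤m

lemma3p2 : (N : ℕ) → 0 < N → σ** N ≡ 3 * N → 3 ^ 3 ∣ N →
    ¬ ((2 ^ 5 ∣ N) × ¬ (2 ^ 6 ∣ N))
lemma3p2 _ _ σ**N≡3N 27∣N (divides m refl , 64∤N) = ratio-32/21-impossible 2∤m 27∣m ratio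
  where
  open ≡-Reasoning
  2∤m : ¬ 2 ∣ m
  2∤m 2∣m = 64∤N (*-monoˡ-∣ 32 2∣m)
  27∣m : 3 ^ 3 ∣ m
  27∣m = coprime-divisor (gcd≡1⇒coprime {27} {32} refl) (subst (27 ∣_) (*-comm m 32) 27∣N)
  ratio : 21 * σ** m ≡ 32 * m
  ratio = *-cancelˡ-≡ (21 * σ** m) (32 * m) 3 (begin
    3 * (21 * σ** m)       ≡⟨ *-assoc 3 21 (σ** m) ⟨
    63 * σ** m             ≡⟨ *-comm 63 (σ** m) ⟩
    σ** m * σ** (2 ^ 5)    ≡⟨ σ**-* (Coprime.sym (prime∤⇒coprime-^ prime[2] 2∤m 5)) ⟨
    σ** (m * 2 ^ 5)        ≡⟨ σ**N≡3N ⟩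
    3 * (m * 32)           ≡⟨ cong (3 *_) (*-comm m 32) ⟩
    3 * (32 * m)           ∎)
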